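{- For every positive integer $n$ there is a subset $\Omega_1\subseteq\Omega_{n,3}$ whose facet gap is $O(2^{ -n/3})$ (with an absolute implied constant).
   Context: $\varepsilon_i:=e_i-\frac1n\mathbb{1}_n\in\mathbb{R}^n$ and $\Omega_{n,3}:=\{(\varepsilon_i,\varepsilon_j,\varepsilon_k):i,j,k\in[n]\}\subseteq\mathbb{R}^{3n}$. The facet gap of a finite set $\Omega$ is the least distance from an element of $\Omega$ to the affine hull of a facet of $\operatorname{conv}(\Omega)$ not containing that element (facets taken relative to the affine hull of $\operatorname{conv}(\Omega)$). -}

module Defs where

open import Data.Nat as ℕ using (ℕ; zero; suc; NonZero)
open import Data.Integer as ℤ using (+_)
open import Data.Rational as ℚ using (ℚ; 0ℚ; 1ℚ; _+_; _*_; _-_; _≤_; _<_)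
open import Data.Fin as Fin using (Fin; remQuot)
open import Data.Product using (Σ; ∃; _×_; _,_; proj₁; proj₂)
open import Relation.Binary.PropositionalEquality using (_≡_)
open import Relation.Nullary using (¬_)
open import Data.Unit using (⊤)

Pt : ℕ → Set
Pt m = Fin m → ℚ

sumFin : ∀ {k} → (Fin k → ℚ) → ℚ
sumFin {zero}  f = 0ℚ
sumFin {suc k} f = f Fin.zero + sumFin (λ i → f (Fin.suc i))

_^ℚ_ : ℚ → ℕ → ℚ
q ^ℚ zero  = 1ℚ
q ^ℚ suc k = q * (q ^ℚ k)

_·_ : ∀ {m} → Pt m → Pt m → ℚ
x · y = sumFin (λ j → x j * y j)

sqDist : ∀ {m} → Pt m → Pt m → ℚ
sqDist x y = (λ j → x j - y j) · (λ j → x j - y j)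

lincomb : ∀ {k m} → (Fin k → ℚ) → (Fin k → Pt m) → Pt m
lincomb c x j = sumFin (λ i → c i * x i j)

-- A finite point configuration: an indexed family  x : Fin N → Pt m.
-- Subsets of the configuration are predicates on indices.

AffIndep : ∀ {k m} → (Fin k → Pt m) → Set
AffIndep x = ∀ c → sumFin c ≡ 0ℚ → (∀ j → lincomb c x j ≡ 0ℚ) → ∀ i → c i ≡ 0ℚ

HasIndep : ∀ {N m} → (Fin N → Pt m) → (Fin N → Set) → ℕ → Set
HasIndep {N} x S k =
  Σ (Fin k → Fin N) λ σ → (∀ i → S (σ i)) × (∀ i i′ → σ i ≡ σ i′ → i ≡ i′) × AffIndep (λ i → x (σ i))

AffDim : ∀ {N m} → (Fin N → Pt m) → (Fin N → Set) → ℕ → Set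
AffDim x S d = HasIndep x S (suc d) × ¬ HasIndep x S (suc (suc d))

InAffHull : ∀ {N m} → (Fin N → Pt m) → (Fin N → Set) → Pt m → Set
InAffHull {N} x S p =
  Σ ℕ λ k → Σ (Fin k → Fin N) λ σ → (∀ i → S (σ i)) ×
    Σ (Fin k → ℚ) λ c → (sumFin c ≡ 1ℚ) × (∀ j → lincomb c (λ i → x (σ i)) j ≡ p j)

OnHyp : ∀ {N m} → (Fin N → Pt m) → Pt m → ℚ → Fin N → Set
OnHyp x a β i = a · x i ≡ β

-- (a, β) exposes a facet of conv Ω: a·xᵢ ≤ β on Ω (supporting hyperplane) and
-- F = Ω ∩ {a·y = β} satisfies dim aff F = dim aff Ω − 1.
-- (Every face of a polytope is exposed by a supporting hyperplane, so facets are
-- exactly the sets OnHyp x a β for such (a, β).)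
ExposesFacet : ∀ {N m} → (Fin N → Pt m) → Pt m → ℚ → Set
ExposesFacet x a β =
  (∀ i → a · x i ≤ β) ×
  Σ ℕ λ d → AffDim x (λ _ → ⊤) (suc d) × AffDim x (OnHyp x a β) d

-- "facet gap of {xᵢ} is ≤ C·2^{-n/3}" for C ≥ 0: some element xᵢ, some facet F
-- not containing xᵢ, and some point p ∈ aff F with |xᵢ − p| ≤ C·2^{-n/3},
-- i.e. (|xᵢ − p|²)³ · 4ⁿ ≤ C⁶.  (The facet gap is a minimum over finitely many
-- pairs, and the distance from a rational point to a rational affine subspace is
-- attained at a rational point, so this is exactly  gap ≤ C·2^{-n/3}.)
FacetGapLE : ∀ {N m} → (Fin N → Pt m) → (C : ℚ) → (n : ℕ) → Set
FacetGapLE {N} {m} x C n =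
  Σ (Fin N) λ i → Σ (Pt m) λ a → Σ ℚ λ β →
    ExposesFacet x a β × ¬ OnHyp x a β i ×
    Σ (Pt m) λ p → InAffHull x (OnHyp x a β) p ×
      ((sqDist (x i) p ^ℚ 3) * (+ (4 ℕ.^ n) ℚ./ 1) ≤ C ^ℚ 6)

ε : (n : ℕ) → .{{NonZero n}} → Fin n → Pt n
ε n i j with i Fin.≟ j
... | Relation.Nullary.yes _ = 1ℚ - (+ 1 ℚ./ n)
... | Relation.Nullary.no  _ = 0ℚ - (+ 1 ℚ./ n)

εTriple : (n : ℕ) → .{{NonZero n}} → Fin n × Fin n × Fin n → Pt (3 ℕ.* n)
εTriple n (i , j , k) c with remQuot {3} n c
... | (Fin.zero , r) = ε n i r
... | (Fin.suc Fin.zero , r) = ε n j r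
... | (Fin.suc (Fin.suc _) , r) = ε n k r

-- a subset Ω₁ ⊆ Ω_{n,3}, given by a finite list (x : Fin N → index triples)
-- of index triples; its points are εTriple n ∘ x

{-# OPTIONS --safe #-}
-- Take n = L + 2 and the 3L + 2 index triples (1,1,1), (0,0,0) and, for every level
-- d < L and position p, the triple with d + 2 at position p and d + 1 elsewhere.
-- Their ε-points are affinely independent: the incidence equations are triangular in
-- the level.  All of them except (1,1,1) satisfy Σ_b α(i_b) = 0 with α(d+1) = −(−2)^d,
-- which therefore exposes a facet.  With q = −1/2, the weights 1 on (1,1,1), −q^L on
-- (0,0,0) and q^(d+1) on the level-d triples sum to zero, and in every block their
-- combination telescopes to q^L (e_(L+1) − e_0).  So (1,1,1) lies at squared distance
-- 6·4^(−L) from the affine hull of the facet, which is O(2^(−n)) ⊆ O(2^(−n/3)).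
module Submission where

open import Defs
open import Data.Nat using (ℕ; NonZero) renaming (_≤_ to _≤ℕ_)
open import Data.Rational using (ℚ; 0ℚ; _≤_)
open import Data.Fin using (Fin)
open import Data.Product using (Σ; _×_)

open import Algebra.Bundles using (CommutativeRing)
open import Data.Fin as F using (zero; suc; _↑ˡ_; _↑ʳ_; combine; punchIn; inject₁; fromℕ; toℕ)
import Data.Fin.Properties as FinP
open import Data.Fin.Induction using (>-weakInduction)
import Data.Integer as ℤ
import Data.Integer.Properties as ℤP
open import Data.Nat as ℕ using (zero; suc)
import Data.Nat.Coprimality as Coprime
import Data.Nat.Properties as ℕP
open import Data.Product using (_,_; proj₁; proj₂; uncurry)
open import Data.Rational using (1ℚ; _+_; _*_; _-_; -_; _/_; _<_; nonNegative; mkℚ)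
open import Data.Rational.Properties
open import Data.Rational.Solver using (module +-*-Solver)
open +-*-Solver using (solve; _:=_; _:+_; _:*_; :-_; _:-_; con)
open import Data.Unit using (⊤; tt)
open import Data.Vec.Functional using (removeAt; _∷_; tail)
open import Function using (_∘_)
open import Function.Definitions using (Injective)
open import Relation.Binary.PropositionalEquality
open import Relation.Nullary using (yes; no; ¬_; contradiction)
open import Relation.Nullary.Decidable using (from-yes)
open import Algebra.Properties.Semiring.Sum (CommutativeRing.semiring +-*-commutativeRing)
  using (sum; sum-remove; sum-init-last; ∑-distrib-+; *-distribˡ-sum)

sumFin≡sum : ∀ {k} (f : Fin k → ℚ) → sumFin f ≡ sum f
sumFin≡sum {zero} f = refl
sumFin≡sum {suc k} f = cong (f zero +_) (sumFin≡sum (λ i → f (suc i)))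

sumFin-cong : ∀ {k} {f g : Fin k → ℚ} → f ≗ g → sumFin f ≡ sumFin g
sumFin-cong {zero} f≗g = refl
sumFin-cong {suc k} f≗g = cong₂ _+_ (f≗g zero) (sumFin-cong (λ i → f≗g (suc i)))

sumFin-zero : ∀ {k} {f : Fin k → ℚ} → (∀ i → f i ≡ 0ℚ) → sumFin f ≡ 0ℚ
sumFin-zero {zero} f≗0 = refl
sumFin-zero {suc k} f≗0 = trans (cong₂ _+_ (f≗0 zero) (sumFin-zero (λ i → f≗0 (suc i)))) (+-identityˡ 0ℚ)

sumFin-+ : ∀ {k} (f g : Fin k → ℚ) → sumFin (λ i → f i + g i) ≡ sumFin f + sumFin g
sumFin-+ f g = begin
  sumFin (λ i → f i + g i) ≡⟨ sumFin≡sum (λ i → f i + g i) ⟩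
  sum (λ i → f i + g i)    ≡⟨ ∑-distrib-+ f g ⟩
  sum f + sum g            ≡⟨ sym (cong₂ _+_ (sumFin≡sum f) (sumFin≡sum g)) ⟩
  sumFin f + sumFin g      ∎
  where open ≡-Reasoning

sumFin-*ˡ : ∀ {k} (x : ℚ) (f : Fin k → ℚ) → sumFin (λ i → x * f i) ≡ x * sumFin f
sumFin-*ˡ x f = begin
  sumFin (λ i → x * f i) ≡⟨ sumFin≡sum (λ i → x * f i) ⟩
  sum (λ i → x * f i)    ≡⟨ sym (*-distribˡ-sum x f) ⟩
  x * sum f              ≡⟨ cong (x *_) (sym (sumFin≡sum f)) ⟩
  x * sumFin f           ∎
  where open ≡-Reasoning

sumFin-*ʳ : ∀ {k} (x : ℚ) (f : Fin k → ℚ) → sumFin (λ i → f i * x) ≡ sumFin f * x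
sumFin-*ʳ x f = trans (sumFin-cong (λ i → *-comm (f i) x)) (trans (sumFin-*ˡ x f) (*-comm x _))

sumFin-neg : ∀ {k} (f : Fin k → ℚ) → sumFin (λ i → - f i) ≡ - sumFin f
sumFin-neg {zero} f = refl
sumFin-neg {suc k} f =
  trans (cong (- f zero +_) (sumFin-neg (λ i → f (suc i)))) (sym (neg-distrib-+ (f zero) _))

sumFin-remove : ∀ {k} (f : Fin (suc k) → ℚ) i → sumFin f ≡ f i + sumFin (removeAt f i)
sumFin-remove f i = begin
  sumFin f                       ≡⟨ sumFin≡sum f ⟩
  sum f                          ≡⟨ sum-remove f ⟩
  f i + sum (removeAt f i)       ≡⟨ cong (f i +_) (sym (sumFin≡sum (removeAt f i))) ⟩
  f i + sumFin (removeAt f i)    ∎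
  where open ≡-Reasoning

sumFin-onePoint : ∀ {k} (f : Fin (suc k) → ℚ) i → (∀ j → j ≢ i → f j ≡ 0ℚ) → sumFin f ≡ f i
sumFin-onePoint f i vanish = begin
  sumFin f                       ≡⟨ sumFin-remove f i ⟩
  f i + sumFin (removeAt f i)    ≡⟨ cong (f i +_) (sumFin-zero (λ j → vanish (punchIn i j) (FinP.punchInᵢ≢i i j))) ⟩
  f i + 0ℚ                       ≡⟨ +-identityʳ (f i) ⟩
  f i                            ∎
  where open ≡-Reasoning

sumFin-init-last : ∀ {k} (f : Fin (suc k) → ℚ) → sumFin f ≡ sumFin (λ i → f (inject₁ i)) + f (fromℕ k)
sumFin-init-last {k} f = begin
  sumFin f                                   ≡⟨ sumFin≡sum f ⟩
  sum f                                      ≡⟨ sum-init-last f ⟩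
  sum (λ i → f (inject₁ i)) + f (fromℕ k)    ≡⟨ cong (_+ f (fromℕ k)) (sym (sumFin≡sum (λ i → f (inject₁ i)))) ⟩
  sumFin (λ i → f (inject₁ i)) + f (fromℕ k) ∎
  where open ≡-Reasoning

sumFin-↑ : ∀ a {b} (f : Fin (a ℕ.+ b) → ℚ) → sumFin f ≡ sumFin (λ i → f (i ↑ˡ b)) + sumFin (λ j → f (a ↑ʳ j))
sumFin-↑ zero f = sym (+-identityˡ _)
sumFin-↑ (suc a) f = trans (cong (f zero +_) (sumFin-↑ a (λ i → f (suc i)))) (sym (+-assoc (f zero) _ _))

sumFin-combine : ∀ k n (f : Fin (k ℕ.* n) → ℚ) → sumFin f ≡ sumFin (λ b → sumFin (λ r → f (combine {k} {n} b r)))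
sumFin-combine zero n f = refl
sumFin-combine (suc k) n f = trans (sumFin-↑ n f) (cong (sumFin (λ r → f (r ↑ˡ (k ℕ.* n))) +_) (sumFin-combine k n (λ j → f (n ↑ʳ j))))

δ : ∀ {m} → Fin m → Fin m → ℚ
δ zero    zero    = 1ℚ
δ zero    (suc _) = 0ℚ
δ (suc _) zero    = 0ℚ
δ (suc i) (suc j) = δ i j

δ-refl : ∀ {m} (i : Fin m) → δ i i ≡ 1ℚ
δ-refl zero    = refl
δ-refl (suc i) = δ-refl i

δ-≢ : ∀ {m} {i j : Fin m} → i ≢ j → δ i j ≡ 0ℚ
δ-≢ {i = zero}  {zero}  i≢j = contradiction refl i≢j
δ-≢ {i = zero}  {suc j} i≢j = refl
δ-≢ {i = suc i} {zero}  i≢j = refl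
δ-≢ {i = suc i} {suc j} i≢j = δ-≢ (λ i≡j → i≢j (cong suc i≡j))

sumFin-*δ : ∀ {m} (f : Fin m → ℚ) i → sumFin (λ r → f r * δ i r) ≡ f i
sumFin-*δ {suc m} f i = trans (sumFin-onePoint (λ r → f r * δ i r) i
  (λ r r≢i → trans (cong (f r *_) (δ-≢ (r≢i ∘ sym))) (*-zeroʳ (f r))))
  (trans (cong (f i *_) (δ-refl i)) (*-identityʳ (f i)))

push : ∀ {N m} → (Fin N → ℚ) → (Fin N → Fin m) → Fin m → ℚ
push c v r = sumFin (λ t → c t * δ (v t) r)

push-congˡ : ∀ {N m} {c c′ : Fin N → ℚ} (v : Fin N → Fin m) → c ≗ c′ → push c v ≗ push c′ v
push-congˡ v c≗c′ r = sumFin-cong (λ t → cong (λ x → x * δ (v t) r) (c≗c′ t))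

push-congʳ : ∀ {N m} (c : Fin N → ℚ) {v v′ : Fin N → Fin m} → v ≗ v′ → push c v ≗ push c v′
push-congʳ c v≗v′ r = sumFin-cong (λ t → cong (λ y → c t * δ y r) (v≗v′ t))

push-image : ∀ {N m} (c : Fin N → ℚ) {v : Fin N → Fin m} → Injective _≡_ _≡_ v → ∀ t → push c v (v t) ≡ c t
push-image {suc N} c {v} v-inj t = trans (sumFin-onePoint (λ s → c s * δ (v s) (v t)) t
  (λ s s≢t → trans (cong (c s *_) (δ-≢ (s≢t ∘ v-inj))) (*-zeroʳ (c s))))
  (trans (cong (c t *_) (δ-refl (v t))) (*-identityʳ (c t)))

push-outside : ∀ {N m} (c : Fin N → ℚ) {v : Fin N → Fin m} {r} → (∀ t → v t ≢ r) → push c v r ≡ 0ℚ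
push-outside c {v} {r} miss = sumFin-zero (λ t → trans (cong (c t *_) (δ-≢ (miss t))) (*-zeroʳ (c t)))

sumFin-*-sub : ∀ {k} (c x : Fin k → ℚ) z → sumFin (λ t → c t * (x t - z)) ≡ sumFin (λ t → c t * x t) - sumFin c * z
sumFin-*-sub c x z = begin
  sumFin (λ t → c t * (x t - z))         ≡⟨ sumFin-cong (λ t → distrib (c t) (x t)) ⟩
  sumFin (λ t → c t * x t + - (c t * z)) ≡⟨ sumFin-+ (λ t → c t * x t) (λ t → - (c t * z)) ⟩
  sumFin (λ t → c t * x t) + sumFin (λ t → - (c t * z))
    ≡⟨ cong (sumFin (λ t → c t * x t) +_) (trans (sumFin-neg (λ t → c t * z)) (cong -_ (sumFin-*ʳ z c))) ⟩
  sumFin (λ t → c t * x t) - sumFin c * z ∎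
  where
  open ≡-Reasoning
  distrib : ∀ a y → a * (y - z) ≡ a * y + - (a * z)
  distrib a y = solve 3 (λ a y z → a :* (y :- z) := a :* y :+ (:- (a :* z))) refl a y z

tuple : ∀ {A : Set} → (Fin 3 → A) → A × A × A
tuple f = f zero , f (suc zero) , f (suc (suc zero))

module _ (n : ℕ) .{{_ : NonZero n}} where

  ε-δ : ∀ i r → ε n i r ≡ δ i r - ℤ.+ 1 / n
  ε-δ i r with i F.≟ r
  ... | yes refl = cong (_- ℤ.+ 1 / n) (sym (δ-refl i))
  ... | no  i≢r  = cong (_- ℤ.+ 1 / n) (sym (δ-≢ i≢r))

  εTriple-combine : ∀ (f : Fin 3 → Fin n) b r → εTriple n (tuple f) (combine b r) ≡ ε n (f b) r
  εTriple-combine f zero r rewrite FinP.remQuot-combine {3} {n} zero r = refl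
  εTriple-combine f (suc zero) r rewrite FinP.remQuot-combine {3} {n} (suc zero) r = refl
  εTriple-combine f (suc (suc zero)) r rewrite FinP.remQuot-combine {3} {n} (suc (suc zero)) r = refl

  lincomb-εTriple : ∀ {N} (c : Fin N → ℚ) (v : Fin N → Fin 3 → Fin n) b r →
    lincomb c (λ t → εTriple n (tuple (v t))) (combine b r) ≡ push c (λ t → v t b) r - sumFin c * (ℤ.+ 1 / n)
  lincomb-εTriple c v b r =
    trans (sumFin-cong (λ t → cong (c t *_) (trans (εTriple-combine (v t) b r) (ε-δ (v t b) r))))
          (sumFin-*-sub c (λ t → δ (v t b) r) (ℤ.+ 1 / n))

  sumFin-*ε : ∀ (g : Fin n → ℚ) i → sumFin (λ r → g r * ε n i r) ≡ g i - sumFin g * (ℤ.+ 1 / n)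
  sumFin-*ε g i =
    trans (sumFin-cong (λ r → cong (g r *_) (ε-δ i r)))
          (trans (sumFin-*-sub g (δ i) (ℤ.+ 1 / n)) (cong (_- _) (sumFin-*δ g i)))

  blockwise : (Fin n → ℚ) → Pt (3 ℕ.* n)
  blockwise α j = α (proj₂ (F.remQuot {3} n j))

  blockwise-·-εTriple : ∀ α (f : Fin 3 → Fin n) →
    blockwise α · εTriple n (tuple f) ≡ sumFin (λ b → α (f b)) + sumFin {3} (λ _ → - (sumFin α * (ℤ.+ 1 / n)))
  blockwise-·-εTriple α f = begin
    sumFin (λ j → blockwise α j * εTriple n (tuple f) j)
      ≡⟨ sumFin-combine 3 n (λ j → blockwise α j * εTriple n (tuple f) j) ⟩
    sumFin (λ b → sumFin (λ r → blockwise α (combine {3} {n} b r) * εTriple n (tuple f) (combine {3} {n} b r)))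
      ≡⟨ sumFin-cong (λ b → sumFin-cong (λ r → cong₂ _*_
           (cong (α ∘ proj₂) (FinP.remQuot-combine {3} {n} b r)) (εTriple-combine f b r))) ⟩
    sumFin (λ b → sumFin (λ r → α r * ε n (f b) r))
      ≡⟨ sumFin-cong (λ b → sumFin-*ε α (f b)) ⟩
    sumFin (λ b → α (f b) - sumFin α * (ℤ.+ 1 / n))
      ≡⟨ sumFin-+ (λ b → α (f b)) (λ _ → - (sumFin α * (ℤ.+ 1 / n))) ⟩
    sumFin (λ b → α (f b)) + sumFin {3} (λ _ → - (sumFin α * (ℤ.+ 1 / n))) ∎
    where open ≡-Reasoning

AffIndep-tail : ∀ {k m} (Y : Fin (suc k) → Pt m) → AffIndep Y → AffIndep (tail Y)
AffIndep-tail Y indep c Σc≡0 lc≡0 i = indep (0ℚ ∷ c) Σ0c≡0 l0c≡0 (suc i)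
  where
  Σ0c≡0 : sumFin (0ℚ ∷ c) ≡ 0ℚ
  Σ0c≡0 = trans (+-identityˡ (sumFin c)) Σc≡0
  l0c≡0 : ∀ j → lincomb (0ℚ ∷ c) Y j ≡ 0ℚ
  l0c≡0 j = trans (cong (_+ lincomb c (tail Y) j) (*-zeroˡ (Y zero j)))
              (trans (+-identityˡ (lincomb c (tail Y) j)) (lc≡0 j))

HasIndep⇒≤ : ∀ {N m k} {x : Fin N → Pt m} {S} → HasIndep x S k → k ℕ.≤ N
HasIndep⇒≤ (σ , _ , σ-inj , _) = FinP.injective⇒≤ (σ-inj _ _)

HasIndep-¬zero⇒≤ : ∀ {N m k} {x : Fin (suc N) → Pt m} {S} → ¬ S zero → HasIndep x S k → k ℕ.≤ N
HasIndep-¬zero⇒≤ {S = S} ¬S0 (σ , inS , σ-inj , _) =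
  FinP.injective⇒≤ (λ {i} {i′} eq → σ-inj i i′ (FinP.punchOut-injective (0≢σ i) (0≢σ i′) eq))
  where
  0≢σ : ∀ i → zero ≢ σ i
  0≢σ i 0≡σi = ¬S0 (subst S (sym 0≡σi) (inS i))

simplex-facet : ∀ {M m} (X : Fin (suc (suc M)) → Pt m) a β → AffIndep X →
  (∀ t → a · X t ≤ β) → (∀ t → OnHyp X a β (suc t)) → ¬ OnHyp X a β zero → ExposesFacet X a β
simplex-facet {M} X a β indep below onHyp ¬onHyp0 =
  below , M , (all , λ h → ℕP.<-irrefl refl (HasIndep⇒≤ {x = X} h)) ,
  (face , λ h → ℕP.<-irrefl refl (HasIndep-¬zero⇒≤ {x = X} {S = OnHyp X a β} ¬onHyp0 h))
  where
  all : HasIndep X (λ _ → ⊤) (suc (suc M))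
  all = (λ t → t) , (λ _ → tt) , (λ _ _ eq → eq) , indep
  face : HasIndep X (OnHyp X a β) (suc M)
  face = suc , onHyp , (λ _ _ → FinP.suc-injective) , AffIndep-tail X indep

lincomb-∷ : ∀ {N m} (c : Fin N → ℚ) (X : Fin (suc N) → Pt m) j →
  lincomb (1ℚ ∷ c) X j ≡ X zero j - lincomb (λ t → - c t) (tail X) j
lincomb-∷ c X j = begin
  1ℚ * X zero j + S                     ≡⟨ solve 2 (λ x s → con 1ℚ :* x :+ s := x :- (:- s)) refl (X zero j) S ⟩
  X zero j - (- S)                      ≡⟨ cong (λ z → X zero j - z) (sym (sumFin-neg (λ t → c t * X (suc t) j))) ⟩
  X zero j - sumFin (λ t → - (c t * X (suc t) j))
    ≡⟨ cong (λ z → X zero j - z) (sumFin-cong (λ t → neg-distribˡ-* (c t) (X (suc t) j))) ⟩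
  X zero j - lincomb (λ t → - c t) (tail X) j ∎
  where
  open ≡-Reasoning
  S = lincomb c (tail X) j

FacetGapLE-witness : ∀ {N m} (X : Fin (suc N) → Pt m) a β (c : Fin N → ℚ) C n →
  ExposesFacet X a β → (∀ t → OnHyp X a β (suc t)) → ¬ OnHyp X a β zero → sumFin c ≡ - 1ℚ →
  ((lincomb (1ℚ ∷ c) X · lincomb (1ℚ ∷ c) X) ^ℚ 3) * (ℤ.+ (4 ℕ.^ n) / 1) ≤ C ^ℚ 6 →
  FacetGapLE X C n
FacetGapLE-witness {N} X a β c C n facet onHyp ¬onHyp0 Σc≡-1 bound =
  zero , a , β , facet , ¬onHyp0 , p , (N , suc , onHyp , (λ t → - c t) , Σ-c≡1 , λ j → refl) ,
  subst (λ d → (d ^ℚ 3) * (ℤ.+ (4 ℕ.^ n) / 1) ≤ C ^ℚ 6) norm≡sqDist bound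
  where
  p = lincomb (λ t → - c t) (tail X)
  Σ-c≡1 : sumFin (λ t → - c t) ≡ 1ℚ
  Σ-c≡1 = trans (sumFin-neg c) (cong -_ Σc≡-1)
  norm≡sqDist : lincomb (1ℚ ∷ c) X · lincomb (1ℚ ∷ c) X ≡ sqDist (X zero) p
  norm≡sqDist = sumFin-cong (λ j → cong₂ _*_ (lincomb-∷ c X j) (lincomb-∷ c X j))

q : ℚ
q = - (ℤ.+ 1 / 2)

geo : ∀ {L} → Fin L → ℚ
geo d = q ^ℚ suc (toℕ d)

sumFin-geo : ∀ L → sumFin {3} (λ _ → sumFin (geo {L})) ≡ q ^ℚ L - 1ℚ
sumFin-geo zero = refl
sumFin-geo (suc L) = begin
  sumFin {3} (λ _ → sumFin (geo {suc L}))
    ≡⟨ sumFin-cong {3} (λ _ → cong (q * 1ℚ +_) (sumFin-*ˡ q (geo {L}))) ⟩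
  sumFin {3} (λ _ → q * 1ℚ + q * s)
    ≡⟨ solve 1 (λ s → (con q :* con 1ℚ :+ con q :* s) :+ ((con q :* con 1ℚ :+ con q :* s) :+ ((con q :* con 1ℚ :+ con q :* s) :+ con 0ℚ))
                  := con q :* (s :+ (s :+ (s :+ con 0ℚ))) :+ con (q + q + q)) refl s ⟩
  q * sumFin {3} (λ _ → s) + (q + q + q)
    ≡⟨ cong (λ z → q * z + (q + q + q)) (sumFin-geo L) ⟩
  q * (q ^ℚ L - 1ℚ) + (q + q + q)
    ≡⟨ solve 1 (λ Q → con q :* (Q :- con 1ℚ) :+ con (q + q + q) := con q :* Q :- con 1ℚ) refl (q ^ℚ L) ⟩
  q ^ℚ suc L - 1ℚ ∎
  where
  open ≡-Reasoning
  s = sumFin (geo {L})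

-- Coordinate e + 1 of every block of the residual combination (cf. push-vertex-suc).
levelResidual : ∀ {L} → Fin (suc L) → ℚ
levelResidual e = 1ℚ * δ zero e + (push geo suc e + sumFin {2} (λ _ → push geo inject₁ e))

levelResidual-inject₁ : ∀ {L} (d : Fin L) → levelResidual (inject₁ d) ≡ 0ℚ
levelResidual-inject₁ {suc L} zero = begin
  1ℚ * 1ℚ + (push g suc zero + sumFin {2} (λ _ → push g inject₁ zero))
    ≡⟨ cong₂ (λ x y → 1ℚ * 1ℚ + (x + (y + (y + 0ℚ))))
         (push-outside g {v = suc} {r = zero} (λ _ ())) (push-image g {v = inject₁} FinP.inject₁-injective zero) ⟩
  1ℚ * 1ℚ + (0ℚ + (q * 1ℚ + (q * 1ℚ + 0ℚ)))
    ≡⟨⟩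
  0ℚ ∎
  where
  open ≡-Reasoning
  g = geo {suc L}
levelResidual-inject₁ {suc L} (suc d) = begin
  1ℚ * 0ℚ + (push g (λ t → t) (inject₁ d) + sumFin {2} (λ _ → push g inject₁ (inject₁ (suc d))))
    ≡⟨ cong₂ (λ x y → 1ℚ * 0ℚ + (x + (y + (y + 0ℚ))))
         (push-image g {v = λ t → t} (λ eq → eq) (inject₁ d)) (push-image g {v = inject₁} FinP.inject₁-injective (suc d)) ⟩
  1ℚ * 0ℚ + (q * (q ^ℚ toℕ (inject₁ d)) + (q * (q * P) + (q * (q * P) + 0ℚ)))
    ≡⟨ cong (λ k → 1ℚ * 0ℚ + (q * (q ^ℚ k) + (q * (q * P) + (q * (q * P) + 0ℚ)))) (FinP.toℕ-inject₁ d) ⟩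
  1ℚ * 0ℚ + (q * P + (q * (q * P) + (q * (q * P) + 0ℚ)))
    ≡⟨ solve 1 (λ P → con 1ℚ :* con 0ℚ :+ (con q :* P :+ (con q :* (con q :* P) :+ (con q :* (con q :* P) :+ con 0ℚ))) := con 0ℚ) refl P ⟩
  0ℚ ∎
  where
  open ≡-Reasoning
  g = geo {suc L}
  P = q ^ℚ toℕ d

levelResidual-fromℕ : ∀ L → levelResidual (fromℕ L) ≡ q ^ℚ L
levelResidual-fromℕ zero = refl
levelResidual-fromℕ (suc L) = begin
  1ℚ * 0ℚ + (push g (λ t → t) (fromℕ L) + sumFin {2} (λ _ → push g inject₁ (fromℕ (suc L))))
    ≡⟨ cong₂ (λ x y → 1ℚ * 0ℚ + (x + (y + (y + 0ℚ))))
         (push-image g {v = λ t → t} (λ eq → eq) (fromℕ L)) (push-outside g {v = inject₁} (λ t → FinP.fromℕ≢inject₁ ∘ sym)) ⟩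
  1ℚ * 0ℚ + (q * (q ^ℚ toℕ (fromℕ L)) + (0ℚ + (0ℚ + 0ℚ)))
    ≡⟨ cong (λ k → 1ℚ * 0ℚ + (q * (q ^ℚ k) + (0ℚ + (0ℚ + 0ℚ)))) (FinP.toℕ-fromℕ L) ⟩
  1ℚ * 0ℚ + (q ^ℚ suc L + (0ℚ + (0ℚ + 0ℚ)))
    ≡⟨ solve 1 (λ Q → con 1ℚ :* con 0ℚ :+ (Q :+ (con 0ℚ :+ (con 0ℚ :+ con 0ℚ))) := Q) refl (q ^ℚ suc L) ⟩
  q ^ℚ suc L ∎
  where
  open ≡-Reasoning
  g = geo {suc L}

sumFin-levelResidual² : ∀ L → sumFin (λ e → levelResidual {L} e * levelResidual e) ≡ q ^ℚ L * q ^ℚ L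
sumFin-levelResidual² L = begin
  sumFin (λ e → levelResidual {L} e * levelResidual e)
    ≡⟨ sumFin-init-last (λ e → levelResidual {L} e * levelResidual e) ⟩
  sumFin (λ d → levelResidual {L} (inject₁ d) * levelResidual (inject₁ d)) + levelResidual (fromℕ L) * levelResidual (fromℕ L)
    ≡⟨ cong₂ _+_ (sumFin-zero (λ d → cong (λ x → x * x) (levelResidual-inject₁ {L} d))) (cong (λ x → x * x) (levelResidual-fromℕ L)) ⟩
  0ℚ + q ^ℚ L * q ^ℚ L
    ≡⟨ +-identityˡ (q ^ℚ L * q ^ℚ L) ⟩
  q ^ℚ L * q ^ℚ L ∎
  where open ≡-Reasoning

rung : ∀ {L} → Fin 3 → Fin 3 → Fin L → Fin (suc L)
rung b p d with b F.≟ p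
... | yes _ = suc d
... | no  _ = inject₁ d

rung-self : ∀ {L} b (d : Fin L) → rung b b d ≡ suc d
rung-self b d with b F.≟ b
... | yes _   = refl
... | no b≢b = contradiction refl b≢b

rung-other : ∀ {L} {b p} (d : Fin L) → b ≢ p → rung b p d ≡ inject₁ d
rung-other {b = b} {p} d b≢p with b F.≟ p
... | yes b≡p = contradiction b≡p b≢p
... | no  _   = refl

sumFin-push-rung : ∀ {L} (w : Fin 3 → Fin L → ℚ) b e →
  sumFin (λ p → push (w p) (rung b p) e) ≡ push (w b) suc e + sumFin (λ j → push (w (punchIn b j)) inject₁ e)
sumFin-push-rung w b e = trans (sumFin-remove (λ p → push (w p) (rung b p) e) b)
  (cong₂ _+_ (push-congʳ (w b) (rung-self b) e)
             (sumFin-cong (λ j → push-congʳ (w (punchIn b j)) (λ d → rung-other d (FinP.punchInᵢ≢i b j ∘ sym)) e)))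

α : ∀ {m} → Fin (suc m) → ℚ
α zero    = 0ℚ
α (suc e) = - ((- (ℤ.+ 2 / 1)) ^ℚ toℕ e)

sumFin-α-rung : ∀ {L} p (d : Fin L) → sumFin (λ b → α {suc L} (suc (rung b p d))) ≡ 0ℚ
sumFin-α-rung p d = begin
  sumFin (λ b → α (suc (rung b p d)))
    ≡⟨ sumFin-remove (λ b → α (suc (rung b p d))) p ⟩
  α (suc (rung p p d)) + sumFin (λ j → α (suc (rung (punchIn p j) p d)))
    ≡⟨ cong₂ _+_ (cong (α ∘ suc) (rung-self p d))
                 (sumFin-cong (λ j → cong (α ∘ suc) (rung-other d (FinP.punchInᵢ≢i p j)))) ⟩
  - (two * (two ^ℚ toℕ d)) + (- (two ^ℚ toℕ (inject₁ d)) + (- (two ^ℚ toℕ (inject₁ d)) + 0ℚ))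
    ≡⟨ cong (λ k → - (two * (two ^ℚ toℕ d)) + (- (two ^ℚ k) + (- (two ^ℚ k) + 0ℚ))) (FinP.toℕ-inject₁ d) ⟩
  - (two * P) + (- P + (- P + 0ℚ))
    ≡⟨ solve 1 (λ P → :- (con two :* P) :+ (:- P :+ (:- P :+ con 0ℚ)) := con 0ℚ) refl P ⟩
  0ℚ ∎
  where
  open ≡-Reasoning
  two = - (ℤ.+ 2 / 1)
  P = two ^ℚ toℕ d

ℕ→ℚ-* : ∀ a b → ℤ.+ (a ℕ.* b) / 1 ≡ (ℤ.+ a / 1) * (ℤ.+ b / 1)
ℕ→ℚ-* a b = trans (cong (_/ 1) (ℤP.pos-* a b)) (sym (cong₂ _*_ (/1≡mkℚ a) (/1≡mkℚ b)))
  where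
  /1≡mkℚ : ∀ k → ℤ.+ k / 1 ≡ mkℚ (ℤ.+ k) 0 (Coprime.sym (Coprime.1-coprimeTo k))
  /1≡mkℚ k = normalize-coprime (Coprime.sym (Coprime.1-coprimeTo k))

q^L²*4^L : ∀ L → (q ^ℚ L * q ^ℚ L) * (ℤ.+ (4 ℕ.^ L) / 1) ≡ 1ℚ
q^L²*4^L zero    = refl
q^L²*4^L (suc L) = begin
  (q * Q * (q * Q)) * (ℤ.+ (4 ℕ.* 4 ℕ.^ L) / 1)  ≡⟨ cong ((q * Q * (q * Q)) *_) (ℕ→ℚ-* 4 (4 ℕ.^ L)) ⟩
  (q * Q * (q * Q)) * ((ℤ.+ 4 / 1) * W)          ≡⟨ solve 2 (λ Q W → (con q :* Q :* (con q :* Q)) :* (con (ℤ.+ 4 / 1) :* W) := (Q :* Q) :* W) refl Q W ⟩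
  (Q * Q) * W                                   ≡⟨ q^L²*4^L L ⟩
  1ℚ ∎
  where
  open ≡-Reasoning
  Q = q ^ℚ L
  W = ℤ.+ (4 ℕ.^ L) / 1

q^L²-bounds : ∀ L → 0ℚ ≤ q ^ℚ L * q ^ℚ L × q ^ℚ L * q ^ℚ L ≤ 1ℚ
q^L²-bounds zero    = from-yes (0ℚ ≤? 1ℚ) , ≤-refl
q^L²-bounds (suc L) =
  subst (0ℚ ≤_) (sym quarter) (*-monoˡ-≤-nonNeg (ℤ.+ 1 / 4) 0≤y) ,
  subst (_≤ 1ℚ) (sym quarter) (≤-trans (*-monoˡ-≤-nonNeg (ℤ.+ 1 / 4) y≤1) (from-yes ((ℤ.+ 1 / 4) * 1ℚ ≤? 1ℚ)))
  where
  Q = q ^ℚ L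
  0≤y = proj₁ (q^L²-bounds L)
  y≤1 = proj₂ (q^L²-bounds L)
  quarter : q * Q * (q * Q) ≡ (ℤ.+ 1 / 4) * (Q * Q)
  quarter = solve 1 (λ Q → con q :* Q :* (con q :* Q) := con (ℤ.+ 1 / 4) :* (Q :* Q)) refl Q

-- With y = q^L·q^L = 4^(-L) the squared distance is 6y, and (6y)³·4^(L+2) = 3456·y² ≤ 4⁶.
residual-bound : ∀ L → let y = q ^ℚ L * q ^ℚ L in
  (sumFin {3} (λ _ → y + y) ^ℚ 3) * (ℤ.+ (4 ℕ.^ suc (suc L)) / 1) ≤ (ℤ.+ 4 / 1) ^ℚ 6
residual-bound L = begin
  (sumFin {3} (λ _ → y + y) ^ℚ 3) * (ℤ.+ (4 ℕ.* (4 ℕ.* 4 ℕ.^ L)) / 1)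
    ≡⟨ cong ((sumFin {3} (λ _ → y + y) ^ℚ 3) *_)
         (trans (ℕ→ℚ-* 4 (4 ℕ.* 4 ℕ.^ L)) (cong ((ℤ.+ 4 / 1) *_) (ℕ→ℚ-* 4 (4 ℕ.^ L)))) ⟩
  (sumFin {3} (λ _ → y + y) ^ℚ 3) * ((ℤ.+ 4 / 1) * ((ℤ.+ 4 / 1) * W))
    ≡⟨ solve 2 (λ y W → (((y :+ y) :+ ((y :+ y) :+ ((y :+ y) :+ con 0ℚ))) :* (((y :+ y) :+ ((y :+ y) :+ ((y :+ y) :+ con 0ℚ)))
                          :* (((y :+ y) :+ ((y :+ y) :+ ((y :+ y) :+ con 0ℚ))) :* con 1ℚ))) :* (con (ℤ.+ 4 / 1) :* (con (ℤ.+ 4 / 1) :* W))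
                   := con (ℤ.+ 3456 / 1) :* ((y :* y) :* (y :* W))) refl y W ⟩
  (ℤ.+ 3456 / 1) * ((y * y) * (y * W))
    ≡⟨ cong (λ z → (ℤ.+ 3456 / 1) * ((y * y) * z)) (q^L²*4^L L) ⟩
  (ℤ.+ 3456 / 1) * ((y * y) * 1ℚ)
    ≤⟨ *-monoˡ-≤-nonNeg (ℤ.+ 3456 / 1) y²≤1 ⟩
  (ℤ.+ 3456 / 1) * 1ℚ
    ≤⟨ from-yes ((ℤ.+ 3456 / 1) * 1ℚ ≤? (ℤ.+ 4 / 1) ^ℚ 6) ⟩
  (ℤ.+ 4 / 1) ^ℚ 6 ∎
  where
  open ≤-Reasoning
  y = q ^ℚ L * q ^ℚ L
  W = ℤ.+ (4 ℕ.^ L) / 1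
  y²≤1 : (y * y) * 1ℚ ≤ 1ℚ
  y²≤1 = ≤-trans (≤-reflexive (*-identityʳ (y * y)))
           (≤-trans (*-monoʳ-≤-nonNeg y {{nonNegative (proj₁ (q^L²-bounds L))}} (proj₂ (q^L²-bounds L)))
                    (≤-trans (≤-reflexive (*-identityˡ y)) (proj₂ (q^L²-bounds L))))

module Construction (L : ℕ) where

  n : ℕ
  n = suc (suc L)

  N : ℕ
  N = suc (suc (3 ℕ.* L))

  vertex : Fin N → Fin 3 → Fin n
  vertex zero          _ = suc zero
  vertex (suc zero)    _ = zero
  vertex (suc (suc i)) b = suc (uncurry (rung b) (F.remQuot {3} L i))

  X : Fin N → Pt (3 ℕ.* n)
  X t = εTriple n (tuple (vertex t))

  tailCoeff : (Fin N → ℚ) → Fin 3 → Fin L → ℚ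
  tailCoeff c p d = c (suc (suc (combine p d)))

  push-vertex : ∀ c b r → push c (λ t → vertex t b) r ≡
    c zero * δ (suc zero) r + (c (suc zero) * δ zero r + sumFin (λ p → push (tailCoeff c p) (λ d → suc (rung b p d)) r))
  push-vertex c b r = cong (λ z → c zero * δ (suc zero) r + (c (suc zero) * δ zero r + z))
    (trans (sumFin-combine 3 L (λ i → c (suc (suc i)) * δ (vertex (suc (suc i)) b) r))
           (sumFin-cong (λ p → sumFin-cong (λ d →
             cong (λ (p′ , d′) → tailCoeff c p d * δ (suc (rung b p′ d′)) r) (FinP.remQuot-combine p d)))))

  push-vertex-zero : ∀ c b → push c (λ t → vertex t b) zero ≡ c (suc zero)
  push-vertex-zero c b = begin
    push c (λ t → vertex t b) zero
      ≡⟨ push-vertex c b zero ⟩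
    c zero * 0ℚ + (c (suc zero) * 1ℚ + sumFin (λ p → push (tailCoeff c p) (λ d → suc (rung b p d)) zero))
      ≡⟨ cong (λ z → c zero * 0ℚ + (c (suc zero) * 1ℚ + z))
           (sumFin-zero (λ p → push-outside (tailCoeff c p) {v = λ d → suc (rung b p d)} {r = zero} (λ _ ()))) ⟩
    c zero * 0ℚ + (c (suc zero) * 1ℚ + 0ℚ)
      ≡⟨ solve 2 (λ x y → x :* con 0ℚ :+ (y :* con 1ℚ :+ con 0ℚ) := y) refl (c zero) (c (suc zero)) ⟩
    c (suc zero) ∎
    where open ≡-Reasoning

  push-vertex-suc : ∀ c b e → push c (λ t → vertex t b) (suc e) ≡
    c zero * δ zero e + (push (tailCoeff c b) suc e + sumFin (λ j → push (tailCoeff c (punchIn b j)) inject₁ e))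
  push-vertex-suc c b e = begin
    push c (λ t → vertex t b) (suc e)
      ≡⟨ push-vertex c b (suc e) ⟩
    c zero * δ zero e + (c (suc zero) * 0ℚ + sumFin (λ p → push (tailCoeff c p) (rung b p) e))
      ≡⟨ cong (λ z → c zero * δ zero e + (c (suc zero) * 0ℚ + z)) (sumFin-push-rung (tailCoeff c) b e) ⟩
    c zero * δ zero e + (c (suc zero) * 0ℚ + T)
      ≡⟨ cong (λ z → c zero * δ zero e + z) (trans (cong (_+ T) (*-zeroʳ (c (suc zero)))) (+-identityˡ T)) ⟩
    c zero * δ zero e + T ∎
    where
    open ≡-Reasoning
    T = push (tailCoeff c b) suc e + sumFin (λ j → push (tailCoeff c (punchIn b j)) inject₁ e)

  X-affIndep : AffIndep X
  X-affIndep c Σc≡0 lc≡0 = c≗0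
    where
    open ≡-Reasoning
    w = tailCoeff c

    block≡0 : ∀ b r → push c (λ t → vertex t b) r ≡ 0ℚ
    block≡0 b r = begin
      push c (λ t → vertex t b) r
        ≡⟨ solve 2 (λ x k → x := x :- con 0ℚ :* k) refl (push c (λ t → vertex t b) r) (ℤ.+ 1 / n) ⟩
      push c (λ t → vertex t b) r - 0ℚ * (ℤ.+ 1 / n)
        ≡⟨ cong (λ s → push c (λ t → vertex t b) r - s * (ℤ.+ 1 / n)) (sym Σc≡0) ⟩
      push c (λ t → vertex t b) r - sumFin c * (ℤ.+ 1 / n)
        ≡⟨ sym (lincomb-εTriple n c vertex b r) ⟩
      lincomb c X (combine b r)
        ≡⟨ lc≡0 (combine b r) ⟩
      0ℚ ∎

    -- Downward induction on the level: the equation of block p at level d + 2 involves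
    -- w p d and otherwise only level-(d + 1) coefficients, which already vanish.
    padded≡0 : ∀ e p → push (w p) inject₁ e ≡ 0ℚ
    padded≡0 = >-weakInduction (λ e → ∀ p → push (w p) inject₁ e ≡ 0ℚ)
      (λ p → push-outside (w p) {v = inject₁} (λ _ → FinP.fromℕ≢inject₁ ∘ sym))
      (λ d above p → begin
        push (w p) inject₁ (inject₁ d)
          ≡⟨ push-image (w p) {v = inject₁} FinP.inject₁-injective d ⟩
        w p d
          ≡⟨ sym (push-image (w p) {v = λ t → t} (λ eq → eq) d) ⟩
        push (w p) (λ t → t) d
          ≡⟨ solve 2 (λ x a → x := a :* con 0ℚ :+ (x :+ con 0ℚ)) refl (push (w p) (λ t → t) d) (c zero) ⟩
        c zero * 0ℚ + (push (w p) (λ t → t) d + 0ℚ)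
          ≡⟨ cong (λ z → c zero * 0ℚ + (push (w p) (λ t → t) d + z)) (sym (sumFin-zero (λ j → above (punchIn p j)))) ⟩
        c zero * 0ℚ + (push (w p) suc (suc d) + sumFin (λ j → push (w (punchIn p j)) inject₁ (suc d)))
          ≡⟨ sym (push-vertex-suc c p (suc d)) ⟩
        push c (λ t → vertex t p) (suc (suc d))
          ≡⟨ block≡0 p (suc (suc d)) ⟩
        0ℚ ∎)

    top≡0 : c zero ≡ 0ℚ
    top≡0 = begin
      c zero
        ≡⟨ solve 1 (λ x → x := x :* con 1ℚ :+ (con 0ℚ :+ con 0ℚ)) refl (c zero) ⟩
      c zero * 1ℚ + (0ℚ + 0ℚ)
        ≡⟨ cong₂ (λ x y → c zero * 1ℚ + (x + y))
             (sym (push-outside (w zero) {v = suc} {r = zero} (λ _ ())))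
             (sym (sumFin-zero (λ j → padded≡0 zero (punchIn zero j)))) ⟩
      c zero * 1ℚ + (push (w zero) suc zero + sumFin (λ j → push (w (punchIn zero j)) inject₁ zero))
        ≡⟨ sym (push-vertex-suc c zero zero) ⟩
      push c (λ t → vertex t zero) (suc zero)
        ≡⟨ block≡0 zero (suc zero) ⟩
      0ℚ ∎

    c≗0 : ∀ t → c t ≡ 0ℚ
    c≗0 zero          = top≡0
    c≗0 (suc zero)    = trans (sym (push-vertex-zero c zero)) (block≡0 zero zero)
    c≗0 (suc (suc i)) = subst (λ i → c (suc (suc i)) ≡ 0ℚ) (FinP.combine-remQuot {3} L i)
      (trans (sym (push-image (w p) {v = inject₁} FinP.inject₁-injective d)) (padded≡0 (inject₁ d) p))
      where
      p = proj₁ (F.remQuot {3} L i)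
      d = proj₂ (F.remQuot {3} L i)

  a : Pt (3 ℕ.* n)
  a = blockwise n α

  β : ℚ
  β = sumFin {3} (λ _ → - (sumFin (α {suc L}) * (ℤ.+ 1 / n)))

  a·X : ∀ t → a · X t ≡ sumFin (λ b → α (vertex t b)) + β
  a·X t = blockwise-·-εTriple n α (vertex t)

  X-onHyp : ∀ t → OnHyp X a β (suc t)
  X-onHyp t = trans (a·X (suc t)) (trans (cong (_+ β) (levelSum t)) (+-identityˡ β))
    where
    levelSum : ∀ t → sumFin (λ b → α (vertex (suc t) b)) ≡ 0ℚ
    levelSum zero    = refl
    levelSum (suc i) = sumFin-α-rung (proj₁ (F.remQuot {3} L i)) (proj₂ (F.remQuot {3} L i))

  X₀-below : a · X zero < β
  X₀-below = <-respʳ-≡ (+-identityˡ β)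
    (<-respˡ-≡ (sym (a·X zero)) (+-monoˡ-< β (from-yes (- (ℤ.+ 3 / 1) <? 0ℚ))))

  X-facet : ExposesFacet X a β
  X-facet = simplex-facet X a β X-affIndep below X-onHyp (λ eq → <-irrefl eq X₀-below)
    where
    below : ∀ t → a · X t ≤ β
    below zero    = <⇒≤ X₀-below
    below (suc t) = ≤-reflexive (X-onHyp t)

  tailWeights : Fin (suc (3 ℕ.* L)) → ℚ
  tailWeights zero    = - (q ^ℚ L)
  tailWeights (suc i) = geo (proj₂ (F.remQuot {3} L i))

  tailCoeff-weights : ∀ p d → tailCoeff (1ℚ ∷ tailWeights) p d ≡ geo d
  tailCoeff-weights p d = cong (geo ∘ proj₂) (FinP.remQuot-combine p d)

  sumFin-tailWeights : sumFin tailWeights ≡ - 1ℚ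
  sumFin-tailWeights = begin
    - (q ^ℚ L) + sumFin (λ i → tailWeights (suc i))
      ≡⟨ cong (- (q ^ℚ L) +_) (sumFin-combine 3 L (λ i → tailWeights (suc i))) ⟩
    - (q ^ℚ L) + sumFin (λ p → sumFin (tailCoeff (1ℚ ∷ tailWeights) p))
      ≡⟨ cong (- (q ^ℚ L) +_) (trans (sumFin-cong (λ p → sumFin-cong (tailCoeff-weights p))) (sumFin-geo L)) ⟩
    - (q ^ℚ L) + (q ^ℚ L - 1ℚ)
      ≡⟨ solve 1 (λ Q → :- Q :+ (Q :- con 1ℚ) := :- con 1ℚ) refl (q ^ℚ L) ⟩
    - 1ℚ ∎
    where open ≡-Reasoning

  residualBlock : Fin n → ℚ
  residualBlock zero    = - (q ^ℚ L)
  residualBlock (suc e) = levelResidual e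

  push-weights : ∀ b r → push (1ℚ ∷ tailWeights) (λ t → vertex t b) r ≡ residualBlock r
  push-weights b zero    = push-vertex-zero (1ℚ ∷ tailWeights) b
  push-weights b (suc e) = trans (push-vertex-suc (1ℚ ∷ tailWeights) b e)
    (cong₂ (λ x y → 1ℚ * δ zero e + (x + y))
      (push-congˡ suc (tailCoeff-weights b) e)
      (sumFin-cong (λ j → push-congˡ inject₁ (tailCoeff-weights (punchIn b j)) e)))

  residual-sqNorm : lincomb (1ℚ ∷ tailWeights) X · lincomb (1ℚ ∷ tailWeights) X ≡
                  sumFin {3} (λ _ → q ^ℚ L * q ^ℚ L + q ^ℚ L * q ^ℚ L)
  residual-sqNorm = begin
    sumFin (λ j → r j * r j)
      ≡⟨ sumFin-combine 3 n (λ j → r j * r j) ⟩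
    sumFin (λ b → sumFin (λ s → r (combine {3} {n} b s) * r (combine b s)))
      ≡⟨ sumFin-cong (λ b → sumFin-cong (λ s → cong (λ x → x * x) (coord b s))) ⟩
    sumFin {3} (λ _ → sumFin (λ s → residualBlock s * residualBlock s))
      ≡⟨ sumFin-cong {3} (λ _ → cong₂ _+_ (solve 1 (λ Q → :- Q :* :- Q := Q :* Q) refl (q ^ℚ L)) (sumFin-levelResidual² L)) ⟩
    sumFin {3} (λ _ → q ^ℚ L * q ^ℚ L + q ^ℚ L * q ^ℚ L) ∎
    where
    open ≡-Reasoning
    r = lincomb (1ℚ ∷ tailWeights) X
    coord : ∀ b s → r (combine {3} {n} b s) ≡ residualBlock s
    coord b s = begin
      r (combine {3} {n} b s)
        ≡⟨ lincomb-εTriple n (1ℚ ∷ tailWeights) vertex b s ⟩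
      push (1ℚ ∷ tailWeights) (λ t → vertex t b) s - (1ℚ + sumFin tailWeights) * (ℤ.+ 1 / n)
        ≡⟨ cong₂ (λ x z → x - (1ℚ + z) * (ℤ.+ 1 / n)) (push-weights b s) sumFin-tailWeights ⟩
      residualBlock s - (1ℚ + - 1ℚ) * (ℤ.+ 1 / n)
        ≡⟨ solve 2 (λ x k → x :- (con 1ℚ :+ :- con 1ℚ) :* k := x) refl (residualBlock s) (ℤ.+ 1 / n) ⟩
      residualBlock s ∎

  gap : FacetGapLE X (ℤ.+ 4 / 1) n
  gap = FacetGapLE-witness X a β tailWeights (ℤ.+ 4 / 1) n X-facet X-onHyp (λ eq → <-irrefl eq X₀-below) sumFin-tailWeights
          (subst (λ d → (d ^ℚ 3) * (ℤ.+ (4 ℕ.^ n) / 1) ≤ (ℤ.+ 4 / 1) ^ℚ 6) (sym residual-sqNorm) (residual-bound L))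

corollary3p6 : Σ ℚ λ C → Σ ℕ λ n₀ → (0ℚ ≤ C) × ((n : ℕ) → .{{_ : NonZero n}} → n₀ ≤ℕ n →
    Σ ℕ λ N → Σ (Fin N → Fin n × Fin n × Fin n) λ ω →
      FacetGapLE (λ t → εTriple n (ω t)) C n)
corollary3p6 = ℤ.+ 4 / 1 , 2 , from-yes (0ℚ ≤? ℤ.+ 4 / 1) , gapFrom2
  where
  gapFrom2 : (n : ℕ) → .{{_ : NonZero n}} → 2 ≤ℕ n →
    Σ ℕ λ N → Σ (Fin N → Fin n × Fin n × Fin n) λ ω → FacetGapLE (λ t → εTriple n (ω t)) (ℤ.+ 4 / 1) n
  gapFrom2 (suc (suc L)) _ = Construction.N L , tuple ∘ Construction.vertex L , Construction.gap L
  gapFrom2 (suc zero) (ℕ.s≤s ())
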